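{- Let $n\ge 1$ and let $C\le \mathbb{F}_2^n$ be a binary linear code which is self-dual ($C=C^{\perp}$ with respect to the standard scalar product $b(x,y)=\sum_{i=1}^n x_iy_i$) and doubly-even (the Hamming weight of every codeword is divisible by $4$). Then the automorphism group $\mathrm{Aut}(C)=\{\pi\in \mathrm{Sym}_n \mid C\pi=C\}$ is contained in the alternating group $\mathrm{Alt}_n$.
   Context: $\mathrm{Sym}_n$ acts on $\mathbb{F}_2^n$ by permuting coordinates. $C^{\perp}=\{v\in\mathbb{F}_2^n\mid b(v,c)=0 \text{ for all } c\in C\}$. -}

module Defs where

open import Data.Bool using (Bool; true; false; _xor_; _∧_)
open import Data.Nat using (ℕ; zero; suc; _%_)
open import Data.Fin using (Fin; toℕ)
open import Data.List using (List; map; allFin; concatMap)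
open import Data.Nat.ListAction using (sum)
open import Data.Product using (_×_; _,_)
open import Data.Fin.Permutation using (Permutation′; _⟨$⟩ʳ_)
open import Relation.Binary.PropositionalEquality using (_≡_)
open import Relation.Nullary.Decidable using (does)
open import Data.Fin using (_<?_)

-- 𝔽₂ is modelled by Bool: addition = xor, multiplication = ∧.
𝔽₂ : Set
𝔽₂ = Bool

Vec𝔽₂ : ℕ → Set
Vec𝔽₂ n = Fin n → 𝔽₂

_⊕_ : ∀ {n} → Vec𝔽₂ n → Vec𝔽₂ n → Vec𝔽₂ n
(x ⊕ y) i = x i xor y i

𝟎 : ∀ {n} → Vec𝔽₂ n
𝟎 _ = false

Σ𝔽₂ : ∀ {n} → (Fin n → 𝔽₂) → 𝔽₂
Σ𝔽₂ {zero} f = false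
Σ𝔽₂ {suc n} f = f Fin.zero xor Σ𝔽₂ (λ i → f (Fin.suc i))
  where import Data.Fin as Fin

b : ∀ {n} → Vec𝔽₂ n → Vec𝔽₂ n → 𝔽₂
b x y = Σ𝔽₂ (λ i → x i ∧ y i)

bit : Bool → ℕ
bit true = 1
bit false = 0

wt : ∀ {n} → Vec𝔽₂ n → ℕ
wt {n} x = sum (map (λ i → bit (x i)) (allFin n))

Subset𝔽₂ : ℕ → Set₁
Subset𝔽₂ n = Vec𝔽₂ n → Set

-- binary linear code: an 𝔽₂-subspace (over 𝔽₂: contains 0 and closed under +)
record IsLinearCode {n : ℕ} (C : Subset𝔽₂ n) : Set where
  field
    zero∈ : C 𝟎
    +-closed : ∀ {x y} → C x → C y → C (x ⊕ y)

_⊥ : ∀ {n} → Subset𝔽₂ n → Subset𝔽₂ n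
(C ⊥) v = ∀ c → C c → b v c ≡ false

_≐_ : ∀ {n} → Subset𝔽₂ n → Subset𝔽₂ n → Set
C ≐ D = ∀ v → (C v → D v) × (D v → C v)

SelfDual : ∀ {n} → Subset𝔽₂ n → Set
SelfDual C = C ≐ (C ⊥)

DoublyEven : ∀ {n} → Subset𝔽₂ n → Set
DoublyEven C = ∀ c → C c → wt c % 4 ≡ 0

-- Sym_n acting on 𝔽₂ⁿ by permuting coordinates: (vπ)_{π(i)} = v_i
_·_ : ∀ {n} → Vec𝔽₂ n → Permutation′ n → Vec𝔽₂ n
(v · π) i = v (π ⟨$⟩ˡ i)
  where open import Data.Fin.Permutation using (_⟨$⟩ˡ_)

_·ˢ_ : ∀ {n} → Subset𝔽₂ n → Permutation′ n → Subset𝔽₂ n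
(C ·ˢ π) v = Σ (Vec𝔽₂ _) (λ c → C c × (∀ i → (c · π) i ≡ v i))
  where open import Data.Product using (Σ)

InAut : ∀ {n} → Subset𝔽₂ n → Permutation′ n → Set
InAut C π = (C ·ˢ π) ≐ C

count : ∀ {A : Set} → (A → Bool) → List A → ℕ
count p xs = sum (map (λ x → bit (p x)) xs)

inversions : ∀ {n} → Permutation′ n → ℕ
inversions {n} π =
  count (λ ij → does (proj₁ ij <? proj₂ ij) ∧ does ((π ⟨$⟩ʳ proj₂ ij) <? (π ⟨$⟩ʳ proj₁ ij)))
        (concatMap (λ i → map (λ j → (i , j)) (allFin n)) (allFin n))
  where open import Data.Product using (proj₁; proj₂)

IsEven : ∀ {n} → Permutation′ n → Set
IsEven π = inversions π % 2 ≡ 0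

module Submission where

-- Let τ = (i j) and u = eᵢ + eⱼ. For Type II (self-dual, doubly even) codes C and D, the codes
-- C ∩ D and C ∩ Dτ contain the same vectors orthogonal to u, and exactly one of them is orthogonal
-- to u: if neither is, witnesses a, b give a ∙ (b + u) both 0 and 1; if both are, then
-- u ∈ (C ∩ D)⊥ = C + D, say u = c + d, and double evenness of c and d forces c ∙ u = 1, so that
-- cτ = d puts c into C ∩ Dτ. Hence |C ∩ Dτ| = 2^{±1} |C ∩ D|. Sorting π by adjacent transpositions,
-- each of which removes exactly one inversion, gives |C| = |C ∩ Cπ| · 2^e with e ≡ inv(π) (mod 2);
-- for π ∈ Aut(C) this forces e = 0. Cardinalities of duals come from |A| |A⊥| = 2ⁿ, proved by
-- double counting.

open import Defs

open import Algebra.Bundles using (CommutativeRing)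
import Algebra.Properties.CommutativeMonoid.Sum as MonoidSum
import Algebra.Properties.CommutativeSemigroup as SemigroupProperties
open import Data.Bool using (Bool; true; false; not; _∧_; _∨_; _xor_)
open import Data.Bool.Properties
  using (xor-comm; xor-assoc; xor-identityʳ; xor-same; ∧-comm; ∧-distribʳ-xor; xor-∧-commutativeRing)
import Data.Bool.Properties as Bool
open import Data.Empty using (⊥; ⊥-elim)
open import Data.Fin using (Fin; toℕ; _<_; _<?_; inject₁; fromℕ) renaming (zero to fzero; suc to fsuc)
open import Data.Fin.Induction using (<-weakInduction; >-weakInduction)
open import Data.Fin.Permutation
  using (Permutation′; _⟨$⟩ʳ_; _⟨$⟩ˡ_; inverseˡ; inverseʳ; _∘ₚ_; flip; transpose)
import Data.Fin.Permutation.Components as PC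
open import Data.Fin.Properties using (_≟_; toℕ-injective; <⇒≢; <-trans)
import Data.Fin.Properties as Fin
open import Data.List using (List; []; _∷_; allFin)
import Data.List as List
import Data.List.Properties as List
open import Data.Nat using (>-nonZero; ℕ; zero; suc; _+_; _*_; _^_; _%_; _≤_; _≥_; z≤n; s≤s)
import Data.Nat as ℕ
open import Data.Nat.DivMod using (%-distribˡ-+; [m+kn]%n≡m%n; [m+n]%n≡m%n)
import Data.Nat.Induction as ℕᵢ
open import Data.Nat.ListAction using (sum)
open import Data.Nat.ListAction.Properties using (sum-++)
open import Data.Nat.Properties
  using ( +-0-commutativeMonoid; +-commutativeSemigroup; +-comm; +-assoc; +-suc; +-identityʳ
        ; +-cancelˡ-≡; +-cancelʳ-≡; +-mono-≤; *-comm; *-assoc; *-identityˡ; *-identityʳ; *-zeroʳ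
        ; *-distribʳ-+; *-cancelˡ-≡; *-cancelʳ-≡; m^n≡1⇒n≡0∨m≡1; m<m*n; <⇒≱
        ; ≤-refl; ≤-trans; ≤-reflexive; m≤m+n; m≤n+m )
import Data.Nat.Properties as ℕₚ
open import Data.Nat.Tactic.RingSolver using (solve-∀)
open import Data.Product using (∃; _×_; _,_; proj₁; proj₂; uncurry)
import Data.Product as Product
open import Data.Sum using (_⊎_; inj₁; inj₂)
open import Data.Vec using (Vec; []; _∷_; lookup; tabulate; zipWith; replicate)
open import Data.Vec.Properties
  using ( lookup∘tabulate; tabulate∘lookup; tabulate-cong; lookup-zipWith; lookup-replicate
        ; zipWith-comm; zipWith-assoc; zipWith-identityˡ; zipWith-identityʳ )
open import Function using (_∘_; id; case_of_)
open import Function.Bundles using (mk⇔)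
open import Induction.WellFounded using (Acc; acc)
open import Relation.Binary.PropositionalEquality
open import Relation.Nullary using (Dec; yes; no; ¬_; does)
open import Relation.Nullary.Decidable
  using (map′; _⊎-dec_; dec-true; dec-false; does-⇔; ¬¬-excluded-middle; decidable-stable)
open import Relation.Nullary.Negation using (¬¬-map)

module ℕΣ = MonoidSum +-0-commutativeMonoid
module ⊕Σ = MonoidSum (CommutativeRing.+-commutativeMonoid xor-∧-commutativeRing)
open SemigroupProperties (CommutativeRing.+-commutativeSemigroup xor-∧-commutativeRing)
  using () renaming (interchange to xor-interchange)
open SemigroupProperties +-commutativeSemigroup using (xy∙z≈xz∙y) renaming (interchange to +-interchange)

-- Vectors rather than the functions of Defs, so that 𝔽₂ⁿ can be enumerated by recursion on n.
Word : ℕ → Set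
Word n = Vec Bool n

infixl 6 _⊞_
_⊞_ : ∀ {n} → Word n → Word n → Word n
_⊞_ = zipWith _xor_

0ʷ : ∀ {n} → Word n
0ʷ = replicate _ false

infix 7 _∙_
_∙_ : ∀ {n} → Word n → Word n → Bool
x ∙ y = ⊕Σ.sum (λ k → lookup x k ∧ lookup y k)

weight : ∀ {n} → Word n → ℕ
weight x = ℕΣ.sum (bit ∘ lookup x)

xor≡false⇒≡ : ∀ {a b} → a xor b ≡ false → a ≡ b
xor≡false⇒≡ {false} {false} _ = refl
xor≡false⇒≡ {true}  {true}  _ = refl

xor≡true⇒≡not : ∀ {a b} → a xor b ≡ true → b ≡ not a
xor≡true⇒≡not {false} {true}  _ = refl
xor≡true⇒≡not {true}  {false} _ = refl

lookup-ext : ∀ {A : Set} {n} {xs ys : Vec A n} → (∀ k → lookup xs k ≡ lookup ys k) → xs ≡ ys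
lookup-ext {xs = xs} {ys} eq = begin
  xs                   ≡⟨ tabulate∘lookup xs ⟨
  tabulate (lookup xs) ≡⟨ tabulate-cong eq ⟩
  tabulate (lookup ys) ≡⟨ tabulate∘lookup ys ⟩
  ys                   ∎
  where open ≡-Reasoning

⊞-comm : ∀ {n} (x y : Word n) → x ⊞ y ≡ y ⊞ x
⊞-comm = zipWith-comm xor-comm

⊞-assoc : ∀ {n} (x y z : Word n) → x ⊞ y ⊞ z ≡ x ⊞ (y ⊞ z)
⊞-assoc = zipWith-assoc xor-assoc

⊞-identityʳ : ∀ {n} (x : Word n) → x ⊞ 0ʷ ≡ x
⊞-identityʳ = zipWith-identityʳ xor-identityʳ

⊞-same : ∀ {n} (x : Word n) → x ⊞ x ≡ 0ʷ
⊞-same []       = refl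
⊞-same (a ∷ x) = cong₂ _∷_ (xor-same a) (⊞-same x)

⊞-identityˡ : ∀ {n} (x : Word n) → 0ʷ ⊞ x ≡ x
⊞-identityˡ = zipWith-identityˡ Bool.xor-identityˡ

⊞-cancelˡ : ∀ {n} (x y : Word n) → x ⊞ (x ⊞ y) ≡ y
⊞-cancelˡ x y = trans (sym (⊞-assoc x x y)) (trans (cong (_⊞ y) (⊞-same x)) (⊞-identityˡ y))

⊞-cancelʳ : ∀ {n} (x y : Word n) → x ⊞ y ⊞ y ≡ x
⊞-cancelʳ x y = trans (⊞-assoc x y y) (trans (cong (x ⊞_) (⊞-same y)) (⊞-identityʳ x))

⊞-interchange : ∀ {n} (w x y z : Word n) → (w ⊞ x) ⊞ (y ⊞ z) ≡ (w ⊞ y) ⊞ (x ⊞ z)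
⊞-interchange []      []      []      []      = refl
⊞-interchange (a ∷ w) (b ∷ x) (c ∷ y) (d ∷ z) = cong₂ _∷_ (xor-interchange a b c d) (⊞-interchange w x y z)

lookup-⊞ : ∀ {n} (x y : Word n) k → lookup (x ⊞ y) k ≡ lookup x k xor lookup y k
lookup-⊞ x y k = lookup-zipWith _xor_ k x y

∙-comm : ∀ {n} (x y : Word n) → x ∙ y ≡ y ∙ x
∙-comm x y = ⊕Σ.sum-cong-≗ (λ k → ∧-comm (lookup x k) (lookup y k))

∙-distribʳ-⊞ : ∀ {n} (x y z : Word n) → (x ⊞ y) ∙ z ≡ x ∙ z xor y ∙ z
∙-distribʳ-⊞ x y z = trans
  (⊕Σ.sum-cong-≗ λ k → trans (cong (_∧ lookup z k) (lookup-⊞ x y k))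
                                (∧-distribʳ-xor (lookup z k) (lookup x k) (lookup y k)))
  (⊕Σ.∑-distrib-+ (λ k → lookup x k ∧ lookup z k) (λ k → lookup y k ∧ lookup z k))

∙-distribˡ-⊞ : ∀ {n} (x y z : Word n) → x ∙ (y ⊞ z) ≡ x ∙ y xor x ∙ z
∙-distribˡ-⊞ x y z = trans (∙-comm x (y ⊞ z))
  (trans (∙-distribʳ-⊞ y z x) (cong₂ _xor_ (∙-comm y x) (∙-comm z x)))

∙-zeroˡ : ∀ {n} (x : Word n) → 0ʷ ∙ x ≡ false
∙-zeroˡ {n} x = trans (⊕Σ.sum-cong-≗ λ k → cong (_∧ lookup x k) (lookup-replicate k false))
                      (⊕Σ.sum-replicate-zero n)

∙-zeroʳ : ∀ {n} (x : Word n) → x ∙ 0ʷ ≡ false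
∙-zeroʳ x = trans (∙-comm x 0ʷ) (∙-zeroˡ x)

permute : ∀ {n} → Permutation′ n → Word n → Word n
permute π x = tabulate (lookup x ∘ (π ⟨$⟩ʳ_))

lookup-permute : ∀ {n} (π : Permutation′ n) x k → lookup (permute π x) k ≡ lookup x (π ⟨$⟩ʳ k)
lookup-permute π x = lookup∘tabulate (lookup x ∘ (π ⟨$⟩ʳ_))

permute-∘ₚ : ∀ {n} (π ρ : Permutation′ n) x → permute (π ∘ₚ ρ) x ≡ permute π (permute ρ x)
permute-∘ₚ π ρ x = lookup-ext λ k →
  trans (lookup-permute (π ∘ₚ ρ) x k)
    (sym (trans (lookup-permute π (permute ρ x) k) (lookup-permute ρ x (π ⟨$⟩ʳ k))))

permute-flip : ∀ {n} (π : Permutation′ n) x → permute π (permute (flip π) x) ≡ x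
permute-flip π x = lookup-ext λ k →
  trans (lookup-permute π (permute (flip π) x) k)
    (trans (lookup-permute (flip π) x (π ⟨$⟩ʳ k)) (cong (lookup x) (inverseˡ π)))

∙-permute : ∀ {n} (π : Permutation′ n) x y → permute π x ∙ permute π y ≡ x ∙ y
∙-permute π x y = trans
  (⊕Σ.sum-cong-≗ λ k → cong₂ _∧_ (lookup-permute π x k) (lookup-permute π y k))
  (sym (⊕Σ.sum-permute (λ k → lookup x k ∧ lookup y k) π))

weight-permute : ∀ {n} (π : Permutation′ n) x → weight (permute π x) ≡ weight x
weight-permute π x = trans
  (ℕΣ.sum-cong-≗ λ k → cong bit (lookup-permute π x k))
  (sym (ℕΣ.sum-permute (bit ∘ lookup x) π))

∑ : ∀ {n} → (Word n → ℕ) → ℕ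
∑ {zero}  f = f []
∑ {suc n} f = ∑ (f ∘ (false ∷_)) + ∑ (f ∘ (true ∷_))

∑-cong : ∀ {n} {f g : Word n → ℕ} → (∀ v → f v ≡ g v) → ∑ f ≡ ∑ g
∑-cong {zero}  eq = eq []
∑-cong {suc n} eq = cong₂ _+_ (∑-cong (eq ∘ (false ∷_))) (∑-cong (eq ∘ (true ∷_)))

∑-distrib-+ : ∀ {n} (f g : Word n → ℕ) → ∑ (λ v → f v + g v) ≡ ∑ f + ∑ g
∑-distrib-+ {zero}  f g = refl
∑-distrib-+ {suc n} f g = trans
  (cong₂ _+_ (∑-distrib-+ (f ∘ (false ∷_)) (g ∘ (false ∷_)))
             (∑-distrib-+ (f ∘ (true ∷_)) (g ∘ (true ∷_))))
  (+-interchange (∑ (f ∘ (false ∷_))) (∑ (g ∘ (false ∷_))) (∑ (f ∘ (true ∷_))) (∑ (g ∘ (true ∷_))))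

∑-*ʳ : ∀ {n} (f : Word n → ℕ) c → ∑ (λ v → f v * c) ≡ ∑ f * c
∑-*ʳ {zero}  f c = refl
∑-*ʳ {suc n} f c = trans (cong₂ _+_ (∑-*ʳ (f ∘ (false ∷_)) c) (∑-*ʳ (f ∘ (true ∷_)) c))
  (sym (*-distribʳ-+ c (∑ (f ∘ (false ∷_))) (∑ (f ∘ (true ∷_)))))

∑-const : ∀ {n} c → ∑ {n} (λ _ → c) ≡ 2 ^ n * c
∑-const {zero}  c = sym (+-identityʳ c)
∑-const {suc n} c = trans (cong₂ _+_ (∑-const {n} c) (∑-const {n} c))
  (trans (cong (2 ^ n * c +_) (sym (+-identityʳ _))) (sym (*-assoc 2 (2 ^ n) c)))

∑-comm : ∀ {m n} (f : Word m → Word n → ℕ) → ∑ (λ v → ∑ (f v)) ≡ ∑ (λ w → ∑ (λ v → f v w))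
∑-comm {zero}  f = refl
∑-comm {suc m} f = trans (cong₂ _+_ (∑-comm (f ∘ (false ∷_))) (∑-comm (f ∘ (true ∷_))))
  (sym (∑-distrib-+ (λ w → ∑ (λ v → f (false ∷ v) w)) (λ w → ∑ (λ v → f (true ∷ v) w))))

∑-translate : ∀ {n} (f : Word n → ℕ) w → ∑ (λ v → f (v ⊞ w)) ≡ ∑ f
∑-translate {zero}  f []          = refl
∑-translate {suc n} f (false ∷ w) =
  cong₂ _+_ (∑-translate (f ∘ (false ∷_)) w) (∑-translate (f ∘ (true ∷_)) w)
∑-translate {suc n} f (true ∷ w)  =
  trans (cong₂ _+_ (∑-translate (f ∘ (true ∷_)) w) (∑-translate (f ∘ (false ∷_)) w))
        (+-comm (∑ (f ∘ (true ∷_))) (∑ (f ∘ (false ∷_))))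

∑-mono : ∀ {n} {f g : Word n → ℕ} → (∀ v → f v ≤ g v) → ∑ f ≤ ∑ g
∑-mono {zero}  le = le []
∑-mono {suc n} le = +-mono-≤ (∑-mono (le ∘ (false ∷_))) (∑-mono (le ∘ (true ∷_)))

term≤∑ : ∀ {n} (f : Word n → ℕ) v → f v ≤ ∑ f
term≤∑ {zero}  f []          = ≤-refl
term≤∑ {suc n} f (false ∷ v) = ≤-trans (term≤∑ (f ∘ (false ∷_)) v) (m≤m+n _ _)
term≤∑ {suc n} f (true ∷ v)  = ≤-trans (term≤∑ (f ∘ (true ∷_)) v) (m≤n+m _ _)

-- A record rather than χ v ≡ true, so that χ can be inferred from membership proofs.
infix 4 _∈_
record _∈_ {n} (v : Word n) (χ : Word n → Bool) : Set where
  constructor mem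
  field ≡true : χ v ≡ true

open _∈_

infixr 7 _∩_
_∩_ : ∀ {n} → (Word n → Bool) → (Word n → Bool) → Word n → Bool
(χ ∩ ψ) v = χ v ∧ ψ v

card : ∀ {n} → (Word n → Bool) → ℕ
card χ = ∑ (bit ∘ χ)

card-cong : ∀ {n} {χ ψ : Word n → Bool} → (∀ v → χ v ≡ ψ v) → card χ ≡ card ψ
card-cong eq = ∑-cong (cong bit ∘ eq)

card-mono : ∀ {n} {χ ψ : Word n → Bool} → (∀ {v} → v ∈ χ → v ∈ ψ) → card χ ≤ card ψ
card-mono {χ = χ} {ψ} ⊆ = ∑-mono λ v → bit-mono (≡true ∘ ⊆ {v} ∘ mem)
  where
  bit-mono : ∀ {a b} → (a ≡ true → b ≡ true) → bit a ≤ bit b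
  bit-mono {false} _  = z≤n
  bit-mono {true}  ab rewrite ab refl = ≤-refl

∈⇒1≤card : ∀ {n} {χ : Word n → Bool} {v} → v ∈ χ → 1 ≤ card χ
∈⇒1≤card {χ = χ} {v} (mem v∈χ) = ≤-trans (≤-reflexive (cong bit (sym v∈χ))) (term≤∑ (bit ∘ χ) v)

anyʷ? : ∀ {n} (p : Word n → Bool) → Dec (∃ λ v → v ∈ p)
anyʷ? {zero}  p = map′ (λ e → [] , mem e) (λ { ([] , mem e) → e }) (p [] Bool.≟ true)
anyʷ? {suc n} p = map′ join split (anyʷ? (p ∘ (false ∷_)) ⊎-dec anyʷ? (p ∘ (true ∷_)))
  where
  join : (∃ λ v → v ∈ p ∘ (false ∷_)) ⊎ (∃ λ v → v ∈ p ∘ (true ∷_)) → ∃ λ v → v ∈ p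
  join (inj₁ (v , mem e)) = false ∷ v , mem e
  join (inj₂ (v , mem e)) = true ∷ v , mem e
  split : (∃ λ v → v ∈ p) → (∃ λ v → v ∈ p ∘ (false ∷_)) ⊎ (∃ λ v → v ∈ p ∘ (true ∷_))
  split (false ∷ v , mem e) = inj₁ (v , mem e)
  split (true ∷ v , mem e)  = inj₂ (v , mem e)

isZero : ∀ {n} → Word n → Bool
isZero []          = true
isZero (false ∷ v) = isZero v
isZero (true ∷ v)  = false

isZero⇒≡0ʷ : ∀ {n} (v : Word n) → isZero v ≡ true → v ≡ 0ʷ
isZero⇒≡0ʷ []          _ = refl
isZero⇒≡0ʷ (false ∷ v) e = cong (false ∷_) (isZero⇒≡0ʷ v e)

¬isZero⇒∙≡true : ∀ {n} (v : Word n) → isZero v ≡ false → ∃ λ y → v ∙ y ≡ true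
¬isZero⇒∙≡true (true ∷ v)  _ = true ∷ 0ʷ , cong (true xor_) (∙-zeroʳ v)
¬isZero⇒∙≡true (false ∷ v) e = let y , v∙y = ¬isZero⇒∙≡true v e in false ∷ y , v∙y

card-isZero : ∀ {n} → card {n} isZero ≡ 1
card-isZero {zero}  = refl
card-isZero {suc n} = trans (cong₂ _+_ (card-isZero {n}) (∑-const {n} 0)) (cong suc (*-zeroʳ (2 ^ n)))

∩⁺ : ∀ {n} {χ ψ : Word n → Bool} {v} → v ∈ χ → v ∈ ψ → v ∈ χ ∩ ψ
∩⁺ (mem v∈χ) (mem v∈ψ) = mem (cong₂ _∧_ v∈χ v∈ψ)

∩⁻ : ∀ {n} {χ ψ : Word n → Bool} {v} → v ∈ χ ∩ ψ → v ∈ χ × v ∈ ψ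
∩⁻ {χ = χ} {ψ} {v} (mem v∈) = Product.map mem mem (split (χ v) (ψ v) v∈)
  where
  split : ∀ a b → a ∧ b ≡ true → a ≡ true × b ≡ true
  split true true _ = refl , refl

record IsSubspace {n} (χ : Word n → Bool) : Set where
  field
    0ʷ∈ : 0ʷ ∈ χ
    ⊞-closed : ∀ {x y} → x ∈ χ → y ∈ χ → x ⊞ y ∈ χ

open IsSubspace

∩-isSubspace : ∀ {n} {χ ψ : Word n → Bool} → IsSubspace χ → IsSubspace ψ → IsSubspace (χ ∩ ψ)
∩-isSubspace S T = record
  { 0ʷ∈      = ∩⁺ (0ʷ∈ S) (0ʷ∈ T)
  ; ⊞-closed = λ x∈ y∈ → ∩⁺ (⊞-closed S (proj₁ (∩⁻ x∈)) (proj₁ (∩⁻ y∈)))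
                             (⊞-closed T (proj₂ (∩⁻ x∈)) (proj₂ (∩⁻ y∈)))
  }

infix 7 _∩⊥_ _∖⊥_
_∩⊥_ _∖⊥_ : ∀ {n} → (Word n → Bool) → Word n → Word n → Bool
(χ ∩⊥ x) a = χ a ∧ not (a ∙ x)
(χ ∖⊥ x) a = χ a ∧ a ∙ x

perp : ∀ {n} → (Word n → Bool) → Word n → Bool
perp χ x = not (does (anyʷ? (χ ∖⊥ x)))

perp-intro : ∀ {n} {χ : Word n → Bool} {x} → (∀ {a} → a ∈ χ → a ∙ x ≡ false) → x ∈ perp χ
perp-intro {χ = χ} {x} ⊥χ = mem (not-true (anyʷ? (χ ∖⊥ x)))
  where
  not-true : (d : Dec (∃ λ a → a ∈ χ ∖⊥ x)) → not (does d) ≡ true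
  not-true (no _) = refl
  not-true (yes (a , a∈χ∩x)) with a∈χ , mem a∙x ← ∩⁻ a∈χ∩x = case trans (sym (⊥χ a∈χ)) a∙x of λ ()

perp-elim : ∀ {n} {χ : Word n → Bool} {x a} → x ∈ perp χ → a ∈ χ → a ∙ x ≡ false
perp-elim {χ = χ} {x} {a} (mem x∈) a∈χ = elim (anyʷ? (χ ∖⊥ x)) x∈
  where
  elim : (d : Dec (∃ λ a → a ∈ χ ∖⊥ x)) → not (does d) ≡ true → a ∙ x ≡ false
  elim (no ∄) _ = Bool.¬-not λ a∙x → ∄ (a , ∩⁺ a∈χ (mem a∙x))

perp-witness : ∀ {n} {χ : Word n → Bool} {x} → perp χ x ≡ false → ∃ λ a → a ∈ χ × a ∙ x ≡ true
perp-witness {χ = χ} {x} x∉ = witness (anyʷ? (χ ∖⊥ x)) x∉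
  where
  witness : (d : Dec (∃ λ a → a ∈ χ ∖⊥ x)) → not (does d) ≡ false → ∃ λ a → a ∈ χ × a ∙ x ≡ true
  witness (yes (a , a∈χ∩x)) _ with a∈χ , mem a∙x ← ∩⁻ a∈χ∩x = a , a∈χ , a∙x

perp-isSubspace : ∀ {n} (χ : Word n → Bool) → IsSubspace (perp χ)
perp-isSubspace χ = record
  { 0ʷ∈      = perp-intro λ {a} _ → ∙-zeroʳ a
  ; ⊞-closed = λ {x} {y} x∈ y∈ → perp-intro λ {a} a∈χ →
      trans (∙-distribˡ-⊞ a x y) (cong₂ _xor_ (perp-elim x∈ a∈χ) (perp-elim y∈ a∈χ))
  }

∈-⇔⇒≡ : ∀ {n} {χ ψ : Word n → Bool} {v w} →
        (v ∈ χ → w ∈ ψ) → (w ∈ ψ → v ∈ χ) → χ v ≡ ψ w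
∈-⇔⇒≡ {χ = χ} {ψ} {v} {w} to from with χ v in eχ | ψ w in eψ
... | true  | true  = refl
... | false | false = refl
... | true  | false = trans (sym (≡true (to (mem eχ)))) eψ
... | false | true  = trans (sym eχ) (≡true (from (mem eψ)))

card-empty : ∀ {n} {χ : Word n → Bool} → (∀ v → χ v ≡ false) → card χ ≡ 0
card-empty {n} empty = trans (∑-cong (cong bit ∘ empty)) (trans (∑-const {n} 0) (*-zeroʳ (2 ^ n)))

full : ∀ {n} → Word n → Bool
full _ = true

full-isSubspace : ∀ {n} → IsSubspace (full {n})
full-isSubspace = record { 0ʷ∈ = mem refl ; ⊞-closed = λ _ _ → mem refl }

card-split : ∀ {n} (χ : Word n → Bool) x → card χ ≡ card (χ ∩⊥ x) + card (χ ∖⊥ x)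
card-split χ x =
  trans (∑-cong λ a → split (χ a) (a ∙ x)) (∑-distrib-+ (bit ∘ (χ ∩⊥ x)) (bit ∘ (χ ∖⊥ x)))
  where
  split : ∀ c d → bit c ≡ bit (c ∧ not d) + bit (c ∧ d)
  split false _     = refl
  split true  false = refl
  split true  true  = refl

module _ {n} {χ : Word n → Bool} {x : Word n} (x∈χ⊥ : x ∈ perp χ) where

  ∩⊥-perp : ∀ a → (χ ∩⊥ x) a ≡ χ a
  ∩⊥-perp a with χ a in a∈χ
  ... | false = refl
  ... | true  = cong not (perp-elim x∈χ⊥ (mem a∈χ))

  ∖⊥-perp : ∀ a → (χ ∖⊥ x) a ≡ false
  ∖⊥-perp a with χ a in a∈χ
  ... | false = refl
  ... | true  = perp-elim x∈χ⊥ (mem a∈χ)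

module _ {n} {χ : Word n → Bool} (S : IsSubspace χ) where

  translate-∈ : ∀ {a₁} a → a₁ ∈ χ → χ (a ⊞ a₁) ≡ χ a
  translate-∈ {a₁} a a₁∈χ = ∈-⇔⇒≡
    (λ a⊞a₁∈χ → subst (_∈ χ) (⊞-cancelʳ a a₁) (⊞-closed S a⊞a₁∈χ a₁∈χ))
    (λ a∈χ → ⊞-closed S a∈χ a₁∈χ)

  -- Translating by a₁ exchanges the two level sets of a ↦ a ∙ x inside χ.
  card-∩⊥≡card-∖⊥ : ∀ {a₁ x} → a₁ ∈ χ → a₁ ∙ x ≡ true → card (χ ∩⊥ x) ≡ card (χ ∖⊥ x)
  card-∩⊥≡card-∖⊥ {a₁} {x} a₁∈χ a₁∙x =
    trans (sym (∑-translate (bit ∘ (χ ∩⊥ x)) a₁)) (∑-cong exchange)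
    where
    exchange : ∀ a → bit ((χ ∩⊥ x) (a ⊞ a₁)) ≡ bit ((χ ∖⊥ x) a)
    exchange a rewrite translate-∈ a a₁∈χ | ∙-distribʳ-⊞ a a₁ x | a₁∙x =
      cong (λ b → bit (χ a ∧ b)) (trans (cong not (xor-comm (a ∙ x) true)) (Bool.not-involutive (a ∙ x)))

  card-∩⊥-¬perp : ∀ {x} → perp χ x ≡ false → card χ ≡ 2 * card (χ ∩⊥ x)
  card-∩⊥-¬perp {x} x∉χ⊥ with a₁ , a₁∈χ , a₁∙x ← perp-witness {x = x} x∉χ⊥ = begin
    card χ                         ≡⟨ card-split χ x ⟩
    card (χ ∩⊥ x) + card (χ ∖⊥ x)  ≡⟨ cong (card (χ ∩⊥ x) +_) (card-∩⊥≡card-∖⊥ {x = x} a₁∈χ a₁∙x) ⟨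
    card (χ ∩⊥ x) + card (χ ∩⊥ x)  ≡⟨ cong (card (χ ∩⊥ x) +_) (+-identityʳ _) ⟨
    2 * card (χ ∩⊥ x)              ∎
    where open ≡-Reasoning

module _ {n} {χ : Word n → Bool} (S : IsSubspace χ) where

  card-∩⊥ : ∀ x → card (χ ∩⊥ x) ≡ card (χ ∖⊥ x) + bit (perp χ x) * card χ
  card-∩⊥ x with perp χ x in x⊥
  ... | true  = trans (card-cong (∩⊥-perp {χ = χ} {x} (mem x⊥)))
                  (sym (cong₂ _+_ (card-empty (∖⊥-perp {χ = χ} {x} (mem x⊥))) (+-identityʳ (card χ))))
  ... | false with a₁ , a₁∈χ , a₁∙x ← perp-witness {x = x} x⊥ =
    trans (card-∩⊥≡card-∖⊥ S {x = x} a₁∈χ a₁∙x) (sym (+-identityʳ _))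

  card-∩⊥-dual : ∀ a → ∑ (λ x → bit ((χ ∩⊥ x) a)) ≡
                       ∑ (λ x → bit ((χ ∖⊥ x) a)) + bit (isZero a) * 2 ^ n
  card-∩⊥-dual a with χ a in a∈χ | isZero a in a≟0
  ... | false | false = sym (+-identityʳ _)
  ... | false | true  = case trans (sym (≡true (subst (_∈ χ) (sym (isZero⇒≡0ʷ a a≟0)) (0ʷ∈ S)))) a∈χ of λ ()
  ... | true  | true  rewrite isZero⇒≡0ʷ a a≟0 = begin
    ∑ (λ x → bit (not (0ʷ {n} ∙ x)))   ≡⟨ ∑-cong {n} (λ x → cong (bit ∘ not) (∙-zeroˡ x)) ⟩
    ∑ {n} (λ _ → 1)                    ≡⟨ ∑-const {n} 1 ⟩
    2 ^ n * 1                          ≡⟨ *-comm (2 ^ n) 1 ⟩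
    1 * 2 ^ n                          ≡⟨ cong (_+ 1 * 2 ^ n) (card-empty {n} (λ x → ∙-zeroˡ x)) ⟨
    ∑ (λ x → bit (0ʷ {n} ∙ x)) + 1 * 2 ^ n ∎
    where open ≡-Reasoning
  ... | true  | false = let y , a∙y = ¬isZero⇒∙≡true a a≟0 in trans
    (∑-cong λ x → cong (bit ∘ not) (∙-comm a x))
    (trans (card-∩⊥≡card-∖⊥ (full-isSubspace {n}) {y} {a} (mem refl) (trans (∙-comm y a) a∙y))
      (trans (∑-cong λ x → cong bit (∙-comm x a)) (sym (+-identityʳ _))))

  -- Count pairs (x, a) with a ∈ χ by the sign of a ∙ x: summing over a gives |χ| or 0 according
  -- as x ∈ χ⊥ (card-∩⊥), summing over x gives 2ⁿ or 0 according as a = 0 (card-∩⊥-dual).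
  card-perp*card : card (perp χ) * card χ ≡ 2 ^ n
  card-perp*card = +-cancelˡ-≡ N₁ _ _ (trans (sym by-rows) by-columns)
    where
    f₀ f₁ : Word n → Word n → ℕ
    f₀ x a = bit ((χ ∩⊥ x) a)
    f₁ x a = bit ((χ ∖⊥ x) a)
    N₁ = ∑ (λ x → ∑ (f₁ x))
    by-rows : ∑ (λ x → ∑ (f₀ x)) ≡ N₁ + card (perp χ) * card χ
    by-rows = begin
      ∑ (λ x → ∑ (f₀ x))                            ≡⟨ ∑-cong card-∩⊥ ⟩
      ∑ (λ x → ∑ (f₁ x) + bit (perp χ x) * card χ)
        ≡⟨ ∑-distrib-+ (λ x → ∑ (f₁ x)) (λ x → bit (perp χ x) * card χ) ⟩
      N₁ + ∑ (λ x → bit (perp χ x) * card χ)         ≡⟨ cong (N₁ +_) (∑-*ʳ (bit ∘ perp χ) (card χ)) ⟩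
      N₁ + card (perp χ) * card χ                    ∎
      where open ≡-Reasoning
    by-columns : ∑ (λ x → ∑ (f₀ x)) ≡ N₁ + 2 ^ n
    by-columns = begin
      ∑ (λ x → ∑ (f₀ x))                                  ≡⟨ ∑-comm f₀ ⟩
      ∑ (λ a → ∑ (λ x → f₀ x a))                          ≡⟨ ∑-cong card-∩⊥-dual ⟩
      ∑ {n} (λ a → ∑ (λ x → f₁ x a) + bit (isZero a) * 2 ^ n)
        ≡⟨ ∑-distrib-+ (λ a → ∑ (λ x → f₁ x a)) (λ a → bit (isZero a) * 2 ^ n) ⟩
      ∑ (λ a → ∑ (λ x → f₁ x a)) + ∑ {n} (λ a → bit (isZero a) * 2 ^ n)
        ≡⟨ cong₂ _+_ (∑-comm (λ a x → f₁ x a)) (∑-*ʳ {n} (bit ∘ isZero) (2 ^ n)) ⟩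
      N₁ + card {n} isZero * 2 ^ n                        ≡⟨ cong (λ c → N₁ + c * 2 ^ n) (card-isZero {n}) ⟩
      N₁ + 1 * 2 ^ n                                      ≡⟨ cong (N₁ +_) (*-identityˡ (2 ^ n)) ⟩
      N₁ + 2 ^ n                                          ∎
      where open ≡-Reasoning

adjoin : ∀ {n} → (Word n → Bool) → Word n → Word n → Bool
adjoin χ u v = χ v ∨ χ (v ⊞ u)

module _ {n} {χ : Word n → Bool} (S : IsSubspace χ) {u : Word n} (u∉χ : ¬ u ∈ χ) where

  private
    ⊞-swap : ∀ (x y z : Word n) → x ⊞ y ⊞ z ≡ x ⊞ z ⊞ y
    ⊞-swap x y z = trans (⊞-assoc x y z) (trans (cong (x ⊞_) (⊞-comm y z)) (sym (⊞-assoc x z y)))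

  adjoin-introˡ : ∀ {v} → v ∈ χ → v ∈ adjoin χ u
  adjoin-introˡ (mem v∈χ) = mem (cong (_∨ χ _) v∈χ)

  adjoin-introʳ : ∀ {v} → v ⊞ u ∈ χ → v ∈ adjoin χ u
  adjoin-introʳ {v} (mem v⊞u∈χ) = mem (trans (cong (χ v ∨_) v⊞u∈χ) (Bool.∨-zeroʳ (χ v)))

  adjoin-elim : ∀ {v} → v ∈ adjoin χ u → v ∈ χ ⊎ v ⊞ u ∈ χ
  adjoin-elim {v} (mem v∈) with χ v in v∈χ
  ... | true  = inj₁ (mem v∈χ)
  ... | false = inj₂ (mem v∈)

  adjoin-isSubspace : IsSubspace (adjoin χ u)
  adjoin-isSubspace = record { 0ʷ∈ = adjoin-introˡ (0ʷ∈ S) ; ⊞-closed = closed }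
    where
    closed : ∀ {x y} → x ∈ adjoin χ u → y ∈ adjoin χ u → x ⊞ y ∈ adjoin χ u
    closed {x} {y} (mem x∈) (mem y∈) with χ x in x∈χ | χ y in y∈χ
    ... | true  | true  = adjoin-introˡ (⊞-closed S (mem x∈χ) (mem y∈χ))
    ... | true  | false = adjoin-introʳ (subst (_∈ χ) (sym (⊞-assoc x y u)) (⊞-closed S (mem x∈χ) (mem y∈)))
    ... | false | true  = adjoin-introʳ (subst (_∈ χ) (⊞-swap x u y) (⊞-closed S (mem x∈) (mem y∈χ)))
    ... | false | false = adjoin-introˡ (subst (_∈ χ) x⊞y≡ (⊞-closed S (mem x∈) (mem y∈)))
      where
      x⊞y≡ : x ⊞ u ⊞ (y ⊞ u) ≡ x ⊞ y
      x⊞y≡ = trans (⊞-interchange x u y u) (trans (cong (x ⊞ y ⊞_) (⊞-same u)) (⊞-identityʳ (x ⊞ y)))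

  card-adjoin : card (adjoin χ u) ≡ 2 * card χ
  card-adjoin = begin
    card (adjoin χ u)                        ≡⟨ ∑-cong disjoint ⟩
    ∑ (λ v → bit (χ v) + bit (χ (v ⊞ u)))     ≡⟨ ∑-distrib-+ (bit ∘ χ) (λ v → bit (χ (v ⊞ u))) ⟩
    card χ + ∑ (λ v → bit (χ (v ⊞ u)))        ≡⟨ cong (card χ +_) (∑-translate (bit ∘ χ) u) ⟩
    card χ + card χ                          ≡⟨ cong (card χ +_) (+-identityʳ (card χ)) ⟨
    2 * card χ                               ∎
    where
    open ≡-Reasoning
    disjoint : ∀ v → bit (χ v ∨ χ (v ⊞ u)) ≡ bit (χ v) + bit (χ (v ⊞ u))
    disjoint v with χ v in v∈χ | χ (v ⊞ u) in v⊞u∈χ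
    ... | true  | true  = ⊥-elim (u∉χ (subst (_∈ χ) (⊞-cancelˡ v u) (⊞-closed S (mem v∈χ) (mem v⊞u∈χ))))
    ... | true  | false = refl
    ... | false | true  = refl
    ... | false | false = refl

  -- Adjoining u to χ halves χ⊥, whereas u ∙ x = false for all x ∈ χ⊥ would give χ⊥ ⊆ (adjoin χ u)⊥.
  perp-separates : ∃ λ x → x ∈ perp χ × u ∙ x ≡ true
  perp-separates with anyʷ? (λ x → perp χ x ∧ u ∙ x)
  ... | yes (x , x∈) = x , Product.map₂ ≡true (∩⁻ x∈)
  ... | no ∄ = ⊥-elim (<⇒≱ shrinks (card-mono ⊆))
    where
    ⊆ : ∀ {x} → x ∈ perp χ → x ∈ perp (adjoin χ u)
    ⊆ {x} x∈ = perp-intro orthogonal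
      where
      u∙x : u ∙ x ≡ false
      u∙x = Bool.¬-not λ u∙x → ∄ (x , ∩⁺ x∈ (mem u∙x))
      orthogonal : ∀ {a} → a ∈ adjoin χ u → a ∙ x ≡ false
      orthogonal {a} a∈ with adjoin-elim a∈
      ... | inj₁ a∈χ   = perp-elim x∈ a∈χ
      ... | inj₂ a⊞u∈χ = begin
        a ∙ x                 ≡⟨ cong (_∙ x) (⊞-cancelʳ a u) ⟨
        (a ⊞ u ⊞ u) ∙ x       ≡⟨ ∙-distribʳ-⊞ (a ⊞ u) u x ⟩
        (a ⊞ u) ∙ x xor u ∙ x ≡⟨ cong₂ _xor_ (perp-elim x∈ a⊞u∈χ) u∙x ⟩
        false                 ∎
        where open ≡-Reasoning
    1≤card : 1 ≤ card χ
    1≤card = ∈⇒1≤card (0ʷ∈ S)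
    halves : card (perp χ) ≡ card (perp (adjoin χ u)) * 2
    halves = *-cancelʳ-≡ _ _ (card χ) {{>-nonZero 1≤card}} (begin
      card (perp χ) * card χ                            ≡⟨ card-perp*card S ⟩
      2 ^ n                                             ≡⟨ card-perp*card adjoin-isSubspace ⟨
      card (perp (adjoin χ u)) * card (adjoin χ u)      ≡⟨ cong (card (perp (adjoin χ u)) *_) card-adjoin ⟩
      card (perp (adjoin χ u)) * (2 * card χ)           ≡⟨ *-assoc (card (perp (adjoin χ u))) 2 (card χ) ⟨
      card (perp (adjoin χ u)) * 2 * card χ             ∎)
      where open ≡-Reasoning
    shrinks : card (perp (adjoin χ u)) ℕ.< card (perp χ)
    shrinks = subst (card (perp (adjoin χ u)) ℕ.<_) (sym halves)
      (m<m*n _ 2 {{>-nonZero (∈⇒1≤card (0ʷ∈ (perp-isSubspace (adjoin χ u))))}} (s≤s (s≤s z≤n)))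

perp-antitone : ∀ {n} {χ ψ : Word n → Bool} {x} →
                (∀ {v} → v ∈ χ → v ∈ ψ) → x ∈ perp ψ → x ∈ perp χ
perp-antitone χ⊆ψ x∈ψ⊥ = perp-intro (perp-elim x∈ψ⊥ ∘ χ⊆ψ)

infixl 6 _+ˢ_
_+ˢ_ : ∀ {n} → (Word n → Bool) → (Word n → Bool) → Word n → Bool
(χ +ˢ ψ) v = does (anyʷ? (λ c → χ c ∧ ψ (v ⊞ c)))

+ˢ-intro : ∀ {n} {χ ψ : Word n → Bool} {v c} → c ∈ χ → v ⊞ c ∈ ψ → v ∈ χ +ˢ ψ
+ˢ-intro {χ = χ} {ψ} {v} {c} c∈χ v⊞c∈ψ =
  mem (dec-true (anyʷ? (λ c → χ c ∧ ψ (v ⊞ c))) (c , ∩⁺ c∈χ (mem (≡true v⊞c∈ψ))))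

+ˢ-elim : ∀ {n} {χ ψ : Word n → Bool} {v} → v ∈ χ +ˢ ψ → ∃ λ c → c ∈ χ × v ⊞ c ∈ ψ
+ˢ-elim {χ = χ} {ψ} {v} (mem v∈) with anyʷ? (λ c → χ c ∧ ψ (v ⊞ c))
... | yes (c , c∈) with c∈χ , mem v⊞c∈ψ ← ∩⁻ c∈ = c , c∈χ , mem v⊞c∈ψ

module _ {n} {χ ψ : Word n → Bool} (S : IsSubspace χ) (T : IsSubspace ψ) where

  +ˢ-isSubspace : IsSubspace (χ +ˢ ψ)
  +ˢ-isSubspace = record
    { 0ʷ∈      = +ˢ-intro (0ʷ∈ S) (subst (_∈ ψ) (sym (⊞-same 0ʷ)) (0ʷ∈ T))
    ; ⊞-closed = closed
    }
    where
    closed : ∀ {x y} → x ∈ χ +ˢ ψ → y ∈ χ +ˢ ψ → x ⊞ y ∈ χ +ˢ ψ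
    closed {x} {y} x∈ y∈
      with c₁ , c₁∈χ , x⊞c₁∈ψ ← +ˢ-elim x∈ | c₂ , c₂∈χ , y⊞c₂∈ψ ← +ˢ-elim y∈ =
      +ˢ-intro (⊞-closed S c₁∈χ c₂∈χ) (subst (_∈ ψ) regroup (⊞-closed T x⊞c₁∈ψ y⊞c₂∈ψ))
      where
      regroup : x ⊞ c₁ ⊞ (y ⊞ c₂) ≡ x ⊞ y ⊞ (c₁ ⊞ c₂)
      regroup = ⊞-interchange x c₁ y c₂

  ⊆+ˢˡ : ∀ {v} → v ∈ χ → v ∈ χ +ˢ ψ
  ⊆+ˢˡ {v} v∈χ = +ˢ-intro v∈χ (subst (_∈ ψ) (sym (⊞-same v)) (0ʷ∈ T))

  ⊆+ˢʳ : ∀ {v} → v ∈ ψ → v ∈ χ +ˢ ψ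
  ⊆+ˢʳ {v} v∈ψ = +ˢ-intro (0ʷ∈ S) (subst (_∈ ψ) (sym (⊞-identityʳ v)) v∈ψ)

-- Transpositions of coordinates

unit : ∀ {n} → Fin n → Word n
unit fzero    = true ∷ 0ʷ
unit (fsuc i) = false ∷ unit i

∙-unit : ∀ {n} (x : Word n) i → x ∙ unit i ≡ lookup x i
∙-unit (a ∷ x) fzero    = trans (cong ((a ∧ true) xor_) (∙-zeroʳ x)) (trans (xor-identityʳ _) (Bool.∧-identityʳ a))
∙-unit (a ∷ x) (fsuc i) = trans (cong (_xor (x ∙ unit i)) (Bool.∧-zeroʳ a)) (∙-unit x i)

lookup-unit-≡ : ∀ {n} (i : Fin n) → lookup (unit i) i ≡ true
lookup-unit-≡ fzero    = refl
lookup-unit-≡ (fsuc i) = lookup-unit-≡ i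

lookup-unit-≢ : ∀ {n} {i k : Fin n} → k ≢ i → lookup (unit i) k ≡ false
lookup-unit-≢ {i = fzero}  {fzero}  k≢i = ⊥-elim (k≢i refl)
lookup-unit-≢ {i = fzero}  {fsuc k} _   = lookup-replicate k false
lookup-unit-≢ {i = fsuc i} {fzero}  _   = refl
lookup-unit-≢ {i = fsuc i} {fsuc k} k≢i = lookup-unit-≢ (k≢i ∘ cong fsuc)

weight-⊞-unit : ∀ {n} (x : Word n) k → weight (x ⊞ unit k) + 2 * bit (lookup x k) ≡ weight x + 1
weight-⊞-unit (a ∷ x) fzero rewrite ⊞-identityʳ x with a
... | true  = +-suc (weight x) 1
... | false = trans (+-identityʳ _) (+-comm 1 (weight x))
weight-⊞-unit (a ∷ x) (fsuc k) rewrite xor-identityʳ a =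
  trans (+-assoc (bit a) (weight (x ⊞ unit k)) _)
    (trans (cong (bit a +_) (weight-⊞-unit x k)) (sym (+-assoc (bit a) (weight x) 1)))

transpose-ˡ : ∀ {n} (i j : Fin n) → PC.transpose i j i ≡ j
transpose-ˡ i j rewrite dec-true (i ≟ i) refl = refl

transpose-ʳ : ∀ {n} (i j : Fin n) → PC.transpose i j j ≡ i
transpose-ʳ i j with j ≟ i
... | yes j≡i = j≡i
... | no  _   rewrite dec-true (j ≟ j) refl = refl

transpose-≢ : ∀ {n} {i j k : Fin n} → k ≢ i → k ≢ j → PC.transpose i j k ≡ k
transpose-≢ {i = i} {j} {k} k≢i k≢j rewrite dec-false (k ≟ i) k≢i | dec-false (k ≟ j) k≢j = refl

transpose-involutive : ∀ {n} (i j k : Fin n) → PC.transpose i j (PC.transpose i j k) ≡ k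
transpose-involutive i j k = cases (k ≟ i) (k ≟ j)
  where
  cases : Dec (k ≡ i) → Dec (k ≡ j) → PC.transpose i j (PC.transpose i j k) ≡ k
  cases (yes refl) _          = trans (cong (PC.transpose k j) (transpose-ˡ k j)) (transpose-ʳ k j)
  cases (no _)     (yes refl) = trans (cong (PC.transpose i k) (transpose-ʳ i k)) (transpose-ˡ i k)
  cases (no k≢i)   (no k≢j)   = trans (cong (PC.transpose i j) (transpose-≢ k≢i k≢j)) (transpose-≢ k≢i k≢j)

module Transposition {n} {i j : Fin n} (i≢j : i ≢ j) where

  τ : Permutation′ n
  τ = transpose i j

  u : Word n
  u = unit i ⊞ unit j

  ∙-u : ∀ x → x ∙ u ≡ lookup x i xor lookup x j
  ∙-u x = trans (∙-distribˡ-⊞ x (unit i) (unit j)) (cong₂ _xor_ (∙-unit x i) (∙-unit x j))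

  lookup-u-≢ : ∀ {k} → k ≢ i → k ≢ j → lookup u k ≡ false
  lookup-u-≢ {k} k≢i k≢j =
    trans (lookup-⊞ (unit i) (unit j) k) (cong₂ _xor_ (lookup-unit-≢ k≢i) (lookup-unit-≢ k≢j))

  lookup-u-i : lookup u i ≡ true
  lookup-u-i = trans (lookup-⊞ (unit i) (unit j) i) (cong₂ _xor_ (lookup-unit-≡ i) (lookup-unit-≢ i≢j))

  lookup-u-j : lookup u j ≡ true
  lookup-u-j = trans (lookup-⊞ (unit i) (unit j) j) (cong₂ _xor_ (lookup-unit-≢ (i≢j ∘ sym)) (lookup-unit-≡ j))

  lookup-⊞u : ∀ x {k} → lookup u k ≡ true → lookup (x ⊞ u) k ≡ not (lookup x k)
  lookup-⊞u x {k} uₖ = trans (lookup-⊞ x u k) (trans (cong (lookup x k xor_) uₖ) (xor-comm (lookup x k) true))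

  permute-τ≡ : ∀ {x y} → lookup x j ≡ lookup y i → lookup x i ≡ lookup y j →
               (∀ {k} → k ≢ i → k ≢ j → lookup x k ≡ lookup y k) → permute τ x ≡ y
  permute-τ≡ {x} {y} at-i at-j elsewhere = lookup-ext λ k → trans (lookup-permute τ x k) (swapped (k ≟ i) (k ≟ j))
    where
    swapped : ∀ {k} → Dec (k ≡ i) → Dec (k ≡ j) → lookup x (PC.transpose i j k) ≡ lookup y k
    swapped (yes refl) _        = trans (cong (lookup x) (transpose-ˡ i j)) at-i
    swapped (no _)     (yes refl) = trans (cong (lookup x) (transpose-ʳ i j)) at-j
    swapped (no k≢i)   (no k≢j)   = trans (cong (lookup x) (transpose-≢ k≢i k≢j)) (elsewhere k≢i k≢j)

  permute-τ-fixes : ∀ x → x ∙ u ≡ false → permute τ x ≡ x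
  permute-τ-fixes x x∙u = permute-τ≡ {x} (sym xᵢ≡xⱼ) xᵢ≡xⱼ (λ _ _ → refl)
    where
    xᵢ≡xⱼ : lookup x i ≡ lookup x j
    xᵢ≡xⱼ = xor≡false⇒≡ (trans (sym (∙-u x)) x∙u)

  permute-τ-moves : ∀ x → x ∙ u ≡ true → permute τ x ≡ x ⊞ u
  permute-τ-moves x x∙u = permute-τ≡ {x}
    (trans xⱼ≡¬xᵢ (sym (lookup-⊞u x lookup-u-i)))
    (trans (sym (trans (cong not xⱼ≡¬xᵢ) (Bool.not-involutive _))) (sym (lookup-⊞u x lookup-u-j)))
    (λ {k} k≢i k≢j → sym (trans (lookup-⊞ x u k)
                                 (trans (cong (lookup x k xor_) (lookup-u-≢ k≢i k≢j)) (xor-identityʳ _))))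
    where
    xⱼ≡¬xᵢ : lookup x j ≡ not (lookup x i)
    xⱼ≡¬xᵢ = xor≡true⇒≡not (trans (sym (∙-u x)) x∙u)

  weight-⊞u : ∀ x → weight (x ⊞ u) + 2 * (bit (lookup x i) + bit (lookup x j)) ≡ weight x + 2
  weight-⊞u x = begin
    weight (x ⊞ u) + 2 * (bᵢ + bⱼ)
      ≡⟨ cong (λ v → weight v + 2 * (bᵢ + bⱼ)) (⊞-assoc x (unit i) (unit j)) ⟨
    weight (y ⊞ unit j) + 2 * (bᵢ + bⱼ)            ≡⟨ regroup (weight (y ⊞ unit j)) bᵢ bⱼ ⟩
    weight (y ⊞ unit j) + 2 * bⱼ + 2 * bᵢ
      ≡⟨ cong (λ b → weight (y ⊞ unit j) + 2 * bit b + 2 * bᵢ) yⱼ≡xⱼ ⟨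
    weight (y ⊞ unit j) + 2 * bit (lookup y j) + 2 * bᵢ ≡⟨ cong (_+ 2 * bᵢ) (weight-⊞-unit y j) ⟩
    weight y + 1 + 2 * bᵢ                          ≡⟨ xy∙z≈xz∙y (weight y) 1 (2 * bᵢ) ⟩
    weight y + 2 * bᵢ + 1                          ≡⟨ cong (_+ 1) (weight-⊞-unit x i) ⟩
    weight x + 1 + 1                               ≡⟨ +-assoc (weight x) 1 1 ⟩
    weight x + 2                                   ∎
    where
    open ≡-Reasoning
    y  = x ⊞ unit i
    bᵢ = bit (lookup x i)
    bⱼ = bit (lookup x j)
    regroup : ∀ w a b → w + 2 * (a + b) ≡ w + 2 * b + 2 * a
    regroup = solve-∀
    yⱼ≡xⱼ : lookup y j ≡ lookup x j
    yⱼ≡xⱼ = trans (lookup-⊞ x (unit i) j)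
              (trans (cong (lookup x j xor_) (lookup-unit-≢ (i≢j ∘ sym))) (xor-identityʳ _))

  weight-⊞u-mod4 : ∀ x → x ∙ u ≡ false → weight x % 4 ≡ 0 → weight (x ⊞ u) % 4 ≡ 2
  weight-⊞u-mod4 x x∙u 4∣x = begin
    weight (x ⊞ u) % 4                               ≡⟨ [m+kn]%n≡m%n (weight (x ⊞ u)) bᵢ 4 ⟨
    (weight (x ⊞ u) + bᵢ * 4) % 4                    ≡⟨ cong (λ t → (weight (x ⊞ u) + t) % 4) (twice bᵢ) ⟩
    (weight (x ⊞ u) + 2 * (bᵢ + bᵢ)) % 4
      ≡⟨ cong (λ b → (weight (x ⊞ u) + 2 * (bᵢ + bit b)) % 4) xᵢ≡xⱼ ⟩
    (weight (x ⊞ u) + 2 * (bᵢ + bit (lookup x j))) % 4 ≡⟨ cong (_% 4) (weight-⊞u x) ⟩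
    (weight x + 2) % 4                               ≡⟨ %-distribˡ-+ (weight x) 2 4 ⟩
    (weight x % 4 + 2) % 4                           ≡⟨ cong (λ r → (r + 2) % 4) 4∣x ⟩
    2                                                ∎
    where
    open ≡-Reasoning
    bᵢ = bit (lookup x i)
    xᵢ≡xⱼ : lookup x i ≡ lookup x j
    xᵢ≡xⱼ = xor≡false⇒≡ (trans (sym (∙-u x)) x∙u)
    twice : ∀ a → a * 4 ≡ 2 * (a + a)
    twice = solve-∀

-- Type II codes

record IsSelfDual {n} (χ : Word n → Bool) : Set where
  field
    self-orthogonal : ∀ {x y} → x ∈ χ → y ∈ χ → x ∙ y ≡ false
    perp-closed     : ∀ {x} → (∀ {y} → y ∈ χ → x ∙ y ≡ false) → x ∈ χ

  isSubspace : IsSubspace χ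
  isSubspace = record
    { 0ʷ∈      = perp-closed λ {y} _ → ∙-zeroˡ y
    ; ⊞-closed = λ {x} {y} x∈χ y∈χ → perp-closed λ {z} z∈χ →
        trans (∙-distribʳ-⊞ x y z) (cong₂ _xor_ (self-orthogonal x∈χ z∈χ) (self-orthogonal y∈χ z∈χ))
    }

  perp⊆ : ∀ {x} → x ∈ perp χ → x ∈ χ
  perp⊆ {x} x∈χ⊥ = perp-closed λ {y} y∈χ → trans (∙-comm x y) (perp-elim x∈χ⊥ y∈χ)

record IsTypeII {n} (χ : Word n → Bool) : Set where
  field
    isSelfDual  : IsSelfDual χ
    doubly-even : ∀ {x} → x ∈ χ → weight x % 4 ≡ 0

open IsSelfDual using (self-orthogonal; perp-closed; isSubspace; perp⊆)
open IsTypeII using (isSelfDual; doubly-even)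

IsSelfDual-permute : ∀ {n} {χ : Word n → Bool} → IsSelfDual χ → ∀ π → IsSelfDual (χ ∘ permute π)
IsSelfDual-permute {χ = χ} SD π = record
  { self-orthogonal = λ {x} {y} (mem x∈) (mem y∈) →
      trans (sym (∙-permute π x y)) (self-orthogonal SD (mem x∈) (mem y∈))
  ; perp-closed     = λ {x} ⊥χπ → mem (≡true (perp-closed SD λ {y} y∈χ → begin
      permute π x ∙ y                              ≡⟨ cong (permute π x ∙_) (permute-flip π y) ⟨
      permute π x ∙ permute π (permute (flip π) y) ≡⟨ ∙-permute π x (permute (flip π) y) ⟩
      x ∙ permute (flip π) y
        ≡⟨ ⊥χπ {permute (flip π) y} (mem (trans (cong χ (permute-flip π y)) (≡true y∈χ))) ⟩
      false                                        ∎))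
  }
  where open ≡-Reasoning

IsTypeII-permute : ∀ {n} {χ : Word n → Bool} → IsTypeII χ → ∀ π → IsTypeII (χ ∘ permute π)
IsTypeII-permute II π = record
  { isSelfDual  = IsSelfDual-permute (isSelfDual II) π
  ; doubly-even = λ {x} (mem x∈) → trans (cong (_% 4) (sym (weight-permute π x))) (doubly-even II (mem x∈))
  }

-- Were u ∉ C + D, separation would give x ∈ (C + D)⊥ = C⊥ ∩ D⊥ = C ∩ D with u ∙ x = true.
perp-∩⊆+ˢ : ∀ {n} {C D : Word n → Bool} → IsSelfDual C → IsSelfDual D →
            ∀ {u} → u ∈ perp (C ∩ D) → u ∈ C +ˢ D
perp-∩⊆+ˢ {C = C} {D} C-SD D-SD {u} u⊥C∩D with (C +ˢ D) u in u∈C+D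
... | true  = mem u∈C+D
... | false
  with x , x∈ , u∙x ← perp-separates (+ˢ-isSubspace (isSubspace C-SD) (isSubspace D-SD))
                                      (λ u∈ → case trans (sym (≡true u∈)) u∈C+D of λ ()) =
  case trans (sym u∙x) (trans (∙-comm u x) (perp-elim u⊥C∩D (∩⁺ x∈C x∈D))) of λ ()
  where
  C-S = isSubspace C-SD
  D-S = isSubspace D-SD
  x∈C : x ∈ C
  x∈C = perp⊆ C-SD (perp-antitone (⊆+ˢˡ C-S D-S) x∈)
  x∈D : x ∈ D
  x∈D = perp⊆ D-SD (perp-antitone (⊆+ˢʳ C-S D-S) x∈)

module _ {n} {C D : Word n → Bool} (C-II : IsTypeII C) (D-II : IsTypeII D) {i j : Fin n} (i≢j : i ≢ j) where

  open Transposition i≢j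

  private
    σ₁ σ₂ : Word n → Bool
    σ₁ = C ∩ D
    σ₂ = C ∩ D ∘ permute τ

    C-SD = isSelfDual C-II
    D-SD = isSelfDual D-II
    C-S  = isSubspace C-SD
    D-S  = isSubspace D-SD

    σ₁-isSubspace : IsSubspace σ₁
    σ₁-isSubspace = ∩-isSubspace C-S D-S

    σ₂-isSubspace : IsSubspace σ₂
    σ₂-isSubspace = ∩-isSubspace C-S (isSubspace (IsSelfDual-permute D-SD τ))

    ∩⊥u-agree : ∀ a → (σ₁ ∩⊥ u) a ≡ (σ₂ ∩⊥ u) a
    ∩⊥u-agree a with a ∙ u in a∙u
    ... | true  = trans (Bool.∧-zeroʳ (σ₁ a)) (sym (Bool.∧-zeroʳ (σ₂ a)))
    ... | false = cong (λ v → (C a ∧ D v) ∧ true) (sym (permute-τ-fixes a a∙u))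

    not-both-orthogonal : u ∈ perp σ₁ → u ∈ perp σ₂ → ⊥
    not-both-orthogonal u⊥σ₁ u⊥σ₂
      with c , c∈C , u⊞c∈D ← +ˢ-elim {χ = C} {D} (perp-∩⊆+ˢ C-SD D-SD u⊥σ₁) =
      case trans (sym (perp-elim u⊥σ₂ (∩⁺ c∈C τc∈D))) c∙u of λ ()
      where
      c⊞u∈D : c ⊞ u ∈ D
      c⊞u∈D = subst (_∈ D) (⊞-comm u c) u⊞c∈D
      c∙u : c ∙ u ≡ true
      c∙u = Bool.¬-not λ c∙u≡false →
        case trans (sym (weight-⊞u-mod4 c c∙u≡false (doubly-even C-II c∈C))) (doubly-even D-II c⊞u∈D) of λ ()
      τc∈D : c ∈ D ∘ permute τ
      τc∈D = mem (trans (cong D (permute-τ-moves c c∙u)) (≡true c⊞u∈D))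

    not-both-nonorthogonal : perp σ₁ u ≡ false → perp σ₂ u ≡ false → ⊥
    not-both-nonorthogonal u∉σ₁⊥ u∉σ₂⊥
      with a , a∈σ₁ , a∙u ← perp-witness {x = u} u∉σ₁⊥
         | b , b∈σ₂ , b∙u ← perp-witness {x = u} u∉σ₂⊥ =
      case trans (sym orthogonal) nonorthogonal of λ ()
      where
      a∈C = proj₁ (∩⁻ {χ = C} {D} a∈σ₁)
      a∈D = proj₂ (∩⁻ {χ = C} {D} a∈σ₁)
      b∈C = proj₁ (∩⁻ {χ = C} {D ∘ permute τ} b∈σ₂)
      τb∈D : permute τ b ∈ D
      τb∈D = mem (≡true (proj₂ (∩⁻ {χ = C} {D ∘ permute τ} b∈σ₂)))
      orthogonal : a ∙ (b ⊞ u) ≡ false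
      orthogonal = trans (cong (a ∙_) (sym (permute-τ-moves b b∙u))) (self-orthogonal D-SD a∈D τb∈D)
      nonorthogonal : a ∙ (b ⊞ u) ≡ true
      nonorthogonal = trans (∙-distribˡ-⊞ a b u) (cong₂ _xor_ (self-orthogonal C-SD a∈C b∈C) a∙u)

  card-transpose : card (C ∩ D ∘ permute τ) ≡ 2 * card (C ∩ D)
                 ⊎ card (C ∩ D) ≡ 2 * card (C ∩ D ∘ permute τ)
  card-transpose with perp σ₁ u in u⊥σ₁ | perp σ₂ u in u⊥σ₂
  ... | true  | true  = ⊥-elim (not-both-orthogonal (mem u⊥σ₁) (mem u⊥σ₂))
  ... | false | false = ⊥-elim (not-both-nonorthogonal u⊥σ₁ u⊥σ₂)
  ... | true  | false = inj₁ (begin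
    card σ₂             ≡⟨ card-∩⊥-¬perp σ₂-isSubspace {u} u⊥σ₂ ⟩
    2 * card (σ₂ ∩⊥ u)  ≡⟨ cong (2 *_) (card-cong ∩⊥u-agree) ⟨
    2 * card (σ₁ ∩⊥ u)  ≡⟨ cong (2 *_) (card-cong (∩⊥-perp {χ = σ₁} {u} (mem u⊥σ₁))) ⟩
    2 * card σ₁         ∎)
    where open ≡-Reasoning
  ... | false | true  = inj₂ (begin
    card σ₁             ≡⟨ card-∩⊥-¬perp σ₁-isSubspace {u} u⊥σ₁ ⟩
    2 * card (σ₁ ∩⊥ u)  ≡⟨ cong (2 *_) (card-cong ∩⊥u-agree) ⟩
    2 * card (σ₂ ∩⊥ u)  ≡⟨ cong (2 *_) (card-cong (∩⊥-perp {χ = σ₂} {u} (mem u⊥σ₂))) ⟩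
    2 * card σ₂         ∎)
    where open ≡-Reasoning

-- Inversions

module AdjacentTransposition {n} {a b : Fin n} (b≡1+a : toℕ b ≡ suc (toℕ a)) where

  τ : Fin n → Fin n
  τ = PC.transpose a b

  a<b : a < b
  a<b = subst (toℕ a ℕ.<_) (sym b≡1+a) (ℕₚ.n<1+n (toℕ a))

  below-b : ∀ {z} → z < b → z ≢ a → z < a
  below-b {z} z<b z≢a = ℕₚ.≤∧≢⇒< (ℕₚ.m<1+n⇒m≤n (subst (toℕ z ℕ.<_) b≡1+a z<b)) (z≢a ∘ toℕ-injective)

  above-a : ∀ {z} → a < z → z ≢ b → b < z
  above-a {z} a<z z≢b = ℕₚ.≤∧≢⇒< (subst (ℕ._≤ toℕ z) (sym b≡1+a) a<z) (z≢b ∘ sym ∘ toℕ-injective)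

  τ-monotone : ∀ {x y} → ¬ (y ≡ a × x ≡ b) → y < x → τ y < τ x
  τ-monotone {x} {y} exception y<x = by-x (x ≟ a) (x ≟ b)
    where
    τy≡y : y ≢ a → y ≢ b → τ y ≡ y
    τy≡y = transpose-≢
    by-x : Dec (x ≡ a) → Dec (x ≡ b) → τ y < τ x
    by-x (yes refl) _ =
      subst₂ _<_ (sym (τy≡y (<⇒≢ y<x) (<⇒≢ (<-trans y<x a<b)))) (sym (transpose-ˡ a b)) (<-trans y<x a<b)
    by-x (no _) (yes refl) = subst₂ _<_ (sym (τy≡y y≢a (<⇒≢ y<x))) (sym (transpose-ʳ a b)) (below-b y<x y≢a)
      where
      y≢a : y ≢ a
      y≢a y≡a = exception (y≡a , refl)
    by-x (no x≢a) (no x≢b) = subst (τ y <_) (sym (transpose-≢ x≢a x≢b)) (by-y (y ≟ a) (y ≟ b))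
      where
      by-y : Dec (y ≡ a) → Dec (y ≡ b) → τ y < x
      by-y (yes refl) _          = subst (_< x) (sym (transpose-ˡ a b)) (above-a y<x x≢b)
      by-y (no _)     (yes refl) = subst (_< x) (sym (transpose-ʳ a b)) (<-trans a<b y<x)
      by-y (no y≢a)   (no y≢b)   = subst (_< x) (sym (τy≡y y≢a y≢b)) y<x

  τ≡a⇒≡b : ∀ {z} → τ z ≡ a → z ≡ b
  τ≡a⇒≡b {z} τz≡a = trans (sym (transpose-involutive a b z)) (trans (cong τ τz≡a) (transpose-ˡ a b))

  τ≡b⇒≡a : ∀ {z} → τ z ≡ b → z ≡ a
  τ≡b⇒≡a {z} τz≡b = trans (sym (transpose-involutive a b z)) (trans (cong τ τz≡b) (transpose-ʳ a b))

  does-<-τ : ∀ {x y} → ¬ (y ≡ a × x ≡ b) → ¬ (y ≡ b × x ≡ a) → does (y <? x) ≡ does (τ y <? τ x)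
  does-<-τ {x} {y} ex₁ ex₂ = does-⇔ (mk⇔ (τ-monotone ex₁) reflect) (y <? x) (τ y <? τ x)
    where
    reflect : τ y < τ x → y < x
    reflect τy<τx = subst₂ _<_ (transpose-involutive a b y) (transpose-involutive a b x)
      (τ-monotone (λ (τy≡a , τx≡b) → ex₂ (τ≡a⇒≡b τy≡a , τ≡b⇒≡a τx≡b)) τy<τx)

sum-update : ∀ {n} (f g : Fin n → ℕ) p → (∀ {k} → k ≢ p → f k ≡ g k) →
             ℕΣ.sum f + g p ≡ ℕΣ.sum g + f p
sum-update {suc n} f g fzero agree = begin
  f fzero + ℕΣ.sum (f ∘ fsuc) + g fzero
    ≡⟨ cong (λ s → f fzero + s + g fzero) (ℕΣ.sum-cong-≗ λ k → agree {fsuc k} λ ()) ⟩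
  f fzero + ℕΣ.sum (g ∘ fsuc) + g fzero ≡⟨ swap (f fzero) (ℕΣ.sum (g ∘ fsuc)) (g fzero) ⟩
  g fzero + ℕΣ.sum (g ∘ fsuc) + f fzero ∎
  where
  open ≡-Reasoning
  swap : ∀ x s y → x + s + y ≡ y + s + x
  swap = solve-∀
sum-update {suc n} f g (fsuc p) agree = begin
  f fzero + ℕΣ.sum (f ∘ fsuc) + g (fsuc p)   ≡⟨ +-assoc (f fzero) _ _ ⟩
  f fzero + (ℕΣ.sum (f ∘ fsuc) + g (fsuc p))
    ≡⟨ cong₂ _+_ (agree λ ()) (sum-update (f ∘ fsuc) (g ∘ fsuc) p (agree ∘ (_∘ Fin.suc-injective))) ⟩
  g fzero + (ℕΣ.sum (g ∘ fsuc) + f (fsuc p)) ≡⟨ +-assoc (g fzero) _ _ ⟨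
  g fzero + ℕΣ.sum (g ∘ fsuc) + f (fsuc p)   ∎
  where open ≡-Reasoning

sum²-update : ∀ {n} (F G : Fin n → Fin n → ℕ) p q → (∀ {i j} → (i , j) ≢ (p , q) → F i j ≡ G i j) →
              ℕΣ.sum (ℕΣ.sum ∘ F) + G p q ≡ ℕΣ.sum (ℕΣ.sum ∘ G) + F p q
sum²-update F G p q agree = +-cancelʳ-≡ (ℕΣ.sum (G p)) _ _ (begin
  A + G p q + ℕΣ.sum (G p)     ≡⟨ xy∙z≈xz∙y A (G p q) (ℕΣ.sum (G p)) ⟩
  A + ℕΣ.sum (G p) + G p q     ≡⟨ cong (_+ G p q) rows ⟩
  B + ℕΣ.sum (F p) + G p q     ≡⟨ +-assoc B (ℕΣ.sum (F p)) (G p q) ⟩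
  B + (ℕΣ.sum (F p) + G p q)   ≡⟨ cong (B +_) row-p ⟩
  B + (ℕΣ.sum (G p) + F p q)   ≡⟨ +-assoc B (ℕΣ.sum (G p)) (F p q) ⟨
  B + ℕΣ.sum (G p) + F p q     ≡⟨ xy∙z≈xz∙y B (ℕΣ.sum (G p)) (F p q) ⟩
  B + F p q + ℕΣ.sum (G p)     ∎)
  where
  open ≡-Reasoning
  A = ℕΣ.sum (ℕΣ.sum ∘ F)
  B = ℕΣ.sum (ℕΣ.sum ∘ G)
  rows : A + ℕΣ.sum (G p) ≡ B + ℕΣ.sum (F p)
  rows = sum-update (ℕΣ.sum ∘ F) (ℕΣ.sum ∘ G) p λ {i} i≢p →
    ℕΣ.sum-cong-≗ λ j → agree {i} {j} (i≢p ∘ cong proj₁)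
  row-p : ℕΣ.sum (F p) + G p q ≡ ℕΣ.sum (G p) + F p q
  row-p = sum-update (F p) (G p) q λ {j} j≢q → agree {p} {j} (j≢q ∘ cong proj₂)

sum-map-allFin : ∀ {n} (f : Fin n → ℕ) → sum (List.map f (allFin n)) ≡ ℕΣ.sum f
sum-map-allFin {n} f = trans (cong sum (List.map-tabulate id f)) (sum-tabulate f)
  where
  sum-tabulate : ∀ {n} (f : Fin n → ℕ) → sum (List.tabulate f) ≡ ℕΣ.sum f
  sum-tabulate {zero}  f = refl
  sum-tabulate {suc n} f = cong (f fzero +_) (sum-tabulate (f ∘ fsuc))

sum-concatMap : ∀ {A B : Set} (f : B → ℕ) (g : A → List B) xs →
                sum (List.map f (List.concatMap g xs)) ≡ sum (List.map (λ x → sum (List.map f (g x))) xs)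
sum-concatMap f g []       = refl
sum-concatMap f g (x ∷ xs) = begin
  sum (List.map f (g x List.++ List.concatMap g xs))                   ≡⟨ cong sum (List.map-++ f (g x) _) ⟩
  sum (List.map f (g x) List.++ List.map f (List.concatMap g xs))     ≡⟨ sum-++ (List.map f (g x)) _ ⟩
  sum (List.map f (g x)) + sum (List.map f (List.concatMap g xs))
    ≡⟨ cong (sum (List.map f (g x)) +_) (sum-concatMap f g xs) ⟩
  sum (List.map f (g x)) + sum (List.map (λ x → sum (List.map f (g x))) xs) ∎
  where open ≡-Reasoning

inverted : ∀ {n} → Permutation′ n → Fin n → Fin n → Bool
inverted π i j = does (i <? j) ∧ does (π ⟨$⟩ʳ j <? π ⟨$⟩ʳ i)

inversions-∑ : ∀ {n} (π : Permutation′ n) → inversions π ≡ ℕΣ.sum (λ i → ℕΣ.sum (bit ∘ inverted π i))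
inversions-∑ {n} π = begin
  inversions π
    ≡⟨ sum-concatMap (bit ∘ uncurry (inverted π)) (λ i → List.map (i ,_) (allFin n)) (allFin n) ⟩
  sum (List.map (λ i → sum (List.map (bit ∘ uncurry (inverted π)) (List.map (i ,_) (allFin n)))) (allFin n))
    ≡⟨ cong sum (List.map-cong (λ i → cong sum (sym (List.map-∘ (allFin n)))) (allFin n)) ⟩
  sum (List.map (λ i → sum (List.map (bit ∘ inverted π i) (allFin n))) (allFin n))
    ≡⟨ cong sum (List.map-cong (λ i → sum-map-allFin (bit ∘ inverted π i)) (allFin n)) ⟩
  sum (List.map (λ i → ℕΣ.sum (bit ∘ inverted π i)) (allFin n))
    ≡⟨ sum-map-allFin (λ i → ℕΣ.sum (bit ∘ inverted π i)) ⟩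
  ℕΣ.sum (λ i → ℕΣ.sum (bit ∘ inverted π i)) ∎
  where open ≡-Reasoning

-- Swapping the adjacent values a and b = a + 1 removes exactly the inversion (π⁻¹ b, π⁻¹ a).
module _ {n} (π : Permutation′ n) {a b : Fin n} (b≡1+a : toℕ b ≡ suc (toℕ a))
         (descent : π ⟨$⟩ˡ b < π ⟨$⟩ˡ a) where

  open AdjacentTransposition b≡1+a

  private
    p q : Fin n
    p = π ⟨$⟩ˡ a
    q = π ⟨$⟩ˡ b

    π′ : Permutation′ n
    π′ = π ∘ₚ transpose a b

    ʳ≡⇒≡ˡ : ∀ {k c} → π ⟨$⟩ʳ k ≡ c → k ≡ π ⟨$⟩ˡ c
    ʳ≡⇒≡ˡ πk≡c = trans (sym (inverseˡ π)) (cong (π ⟨$⟩ˡ_) πk≡c)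

    not-ab : ∀ {i j} → (i , j) ≢ (q , p) → ¬ (π ⟨$⟩ʳ j ≡ a × π ⟨$⟩ʳ i ≡ b)
    not-ab ij≢qp (πj≡a , πi≡b) = ij≢qp (cong₂ _,_ (ʳ≡⇒≡ˡ πi≡b) (ʳ≡⇒≡ˡ πj≡a))

    q≮p : does (p <? q) ≡ false
    q≮p = dec-false (p <? q) (Fin.<-asym descent)

    inverted-agree : ∀ {i j} → (i , j) ≢ (q , p) → inverted π i j ≡ inverted π′ i j
    inverted-agree {i} {j} ij≢qp with i ≟ p | j ≟ q
    ... | yes refl | yes refl =
      trans (cong (_∧ does (π ⟨$⟩ʳ q <? π ⟨$⟩ʳ p)) q≮p) (sym (cong (_∧ does (π′ ⟨$⟩ʳ q <? π′ ⟨$⟩ʳ p)) q≮p))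
    ... | no i≢p   | _        = cong (does (i <? j) ∧_)
      (does-<-τ (not-ab ij≢qp) λ (_ , πi≡a) → i≢p (ʳ≡⇒≡ˡ πi≡a))
    ... | yes _    | no j≢q   = cong (does (i <? j) ∧_)
      (does-<-τ (not-ab ij≢qp) λ (πj≡b , _) → j≢q (ʳ≡⇒≡ˡ πj≡b))

    inverted-qp : inverted π q p ≡ true
    inverted-qp rewrite inverseʳ π {a} | inverseʳ π {b} = cong₂ _∧_ (dec-true (q <? p) descent) (dec-true (a <? b) a<b)

    not-inverted′-qp : inverted π′ q p ≡ false
    not-inverted′-qp rewrite inverseʳ π {a} | inverseʳ π {b} | transpose-ˡ a b | transpose-ʳ a b =
      trans (cong (does (q <? p) ∧_) (dec-false (b <? a) (Fin.<-asym a<b))) (Bool.∧-zeroʳ _)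

  inversions-transpose : inversions π ≡ suc (inversions π′)
  inversions-transpose = begin
    inversions π                                          ≡⟨ +-identityʳ _ ⟨
    inversions π + 0
      ≡⟨ cong₂ _+_ (inversions-∑ π) (cong bit (sym not-inverted′-qp)) ⟩
    ℕΣ.sum (ℕΣ.sum ∘ F) + bit (inverted π′ q p)
      ≡⟨ sum²-update F (λ i → bit ∘ inverted π′ i) q p (cong bit ∘ inverted-agree) ⟩
    ℕΣ.sum (λ i → ℕΣ.sum (bit ∘ inverted π′ i)) + bit (inverted π q p)
      ≡⟨ cong₂ _+_ (inversions-∑ π′) (cong bit (sym inverted-qp)) ⟨
    inversions π′ + 1                                     ≡⟨ +-comm (inversions π′) 1 ⟩
    suc (inversions π′)                                   ∎
    where
    open ≡-Reasoning
    F = λ i → bit ∘ inverted π i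

Descent : ∀ {m} → Permutation′ (suc m) → Fin m → Set
Descent π i = π ⟨$⟩ˡ fsuc i < π ⟨$⟩ˡ inject₁ i

descent? : ∀ {m} (π : Permutation′ (suc m)) → Dec (∃ (Descent π))
descent? π = Fin.any? λ i → π ⟨$⟩ˡ fsuc i <? π ⟨$⟩ˡ inject₁ i

module _ {m} (π : Permutation′ (suc m)) (no-descent : ∀ i → ¬ Descent π i) where

  private
    σ : Fin (suc m) → Fin (suc m)
    σ = π ⟨$⟩ˡ_

    ascending : ∀ i → σ (inject₁ i) < σ (fsuc i)
    ascending i = ℕₚ.≤∧≢⇒< (ℕₚ.≮⇒≥ (no-descent i)) λ σi≡σi+1 → ℕₚ.1+n≢n (begin
      toℕ (fsuc i)         ≡⟨ cong toℕ (inverseʳ π) ⟨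
      toℕ (π ⟨$⟩ʳ σ (fsuc i)) ≡⟨ cong (toℕ ∘ (π ⟨$⟩ʳ_)) (toℕ-injective σi≡σi+1) ⟨
      toℕ (π ⟨$⟩ʳ σ (inject₁ i)) ≡⟨ cong toℕ (inverseʳ π) ⟩
      toℕ (inject₁ i)      ≡⟨ Fin.toℕ-inject₁ i ⟩
      toℕ i                ∎)
      where open ≡-Reasoning

    σ-inflationary : ∀ k → toℕ k ≤ toℕ (σ k)
    σ-inflationary = <-weakInduction (λ k → toℕ k ≤ toℕ (σ k)) z≤n λ i i≤σi →
      ≤-trans (s≤s (subst (_≤ toℕ (σ (inject₁ i))) (Fin.toℕ-inject₁ i) i≤σi)) (ascending i)

    σ-deflationary : ∀ k → toℕ (σ k) ≤ toℕ k
    σ-deflationary = >-weakInduction (λ k → toℕ (σ k) ≤ toℕ k)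
      (subst (toℕ (σ (fromℕ m)) ≤_) (sym (Fin.toℕ-fromℕ m)) (Fin.toℕ≤pred[n] (σ _))) λ i σi+1≤i+1 →
      subst (toℕ (σ (inject₁ i)) ≤_) (sym (Fin.toℕ-inject₁ i))
        (ℕₚ.m<1+n⇒m≤n (ℕₚ.<-≤-trans (ascending i) σi+1≤i+1))

  no-descent⇒identity : ∀ k → π ⟨$⟩ʳ k ≡ k
  no-descent⇒identity k = trans (cong (π ⟨$⟩ʳ_) (sym σk≡k)) (inverseʳ π)
    where
    σk≡k : σ k ≡ k
    σk≡k = toℕ-injective (ℕₚ.≤-antisym (σ-deflationary k) (σ-inflationary k))

inversions-identity : ∀ {n} (π : Permutation′ n) → (∀ k → π ⟨$⟩ʳ k ≡ k) → inversions π ≡ 0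
inversions-identity {n} π π≗id = trans (inversions-∑ π)
  (trans (ℕΣ.sum-cong-≗ λ i → trans (ℕΣ.sum-cong-≗ λ j → cong bit (not-inverted i j)) (ℕΣ.sum-replicate-zero n))
    (ℕΣ.sum-replicate-zero n))
  where
  not-inverted : ∀ i j → inverted π i j ≡ false
  not-inverted i j rewrite π≗id i | π≗id j = asymmetric (i <? j) (j <? i)
    where
    asymmetric : (i<?j : Dec (i < j)) (j<?i : Dec (j < i)) → does i<?j ∧ does j<?i ≡ false
    asymmetric (no _)    _         = refl
    asymmetric (yes _)   (no _)    = refl
    asymmetric (yes i<j) (yes j<i) = ⊥-elim (Fin.<-asym i<j j<i)

-- The index of C ∩ Cπ in C

%2-suc : ∀ {a b} → a % 2 ≡ b % 2 → suc a % 2 ≡ suc b % 2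
%2-suc {a} {b} a≡b = trans (%-distribˡ-+ 1 a 2) (trans (cong (λ r → (1 + r) % 2) a≡b) (sym (%-distribˡ-+ 1 b 2)))

-- Halving or doubling c moves the exponent by one; c′ ≤ N excludes doubling at exponent 0.
rescale : ∀ {N c c′} e → N ≡ c * 2 ^ e → 1 ≤ c → c′ ≤ N → c ≡ 2 * c′ ⊎ c′ ≡ 2 * c →
          ∃ λ e′ → N ≡ c′ * 2 ^ e′ × e′ % 2 ≡ suc e % 2
rescale {N} {c} {c′} e N≡c2ᵉ _ _ (inj₁ c≡2c′) = suc e , (begin
  N                 ≡⟨ N≡c2ᵉ ⟩
  c * 2 ^ e         ≡⟨ cong (_* 2 ^ e) c≡2c′ ⟩
  2 * c′ * 2 ^ e    ≡⟨ cong (_* 2 ^ e) (*-comm 2 c′) ⟩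
  c′ * 2 * 2 ^ e    ≡⟨ *-assoc c′ 2 (2 ^ e) ⟩
  c′ * 2 ^ suc e    ∎) , refl
  where open ≡-Reasoning
rescale {N} {c} {c′} zero N≡c 1≤c c′≤N (inj₂ c′≡2c) = ⊥-elim (<⇒≱ c<c′ (≤-trans c′≤N (≤-reflexive N≡c)))
  where
  c<c′ : c * 1 ℕ.< c′
  c<c′ = subst₂ ℕ._<_ (sym (*-identityʳ c)) (trans (*-comm c 2) (sym c′≡2c))
           (m<m*n c 2 {{>-nonZero 1≤c}} (s≤s (s≤s z≤n)))
rescale {N} {c} {c′} (suc e) N≡c2ᵉ _ _ (inj₂ c′≡2c) = e , (begin
  N                 ≡⟨ N≡c2ᵉ ⟩
  c * (2 * 2 ^ e)   ≡⟨ *-assoc c 2 (2 ^ e) ⟨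
  c * 2 * 2 ^ e     ≡⟨ cong (_* 2 ^ e) (trans (*-comm c 2) (sym c′≡2c)) ⟩
  c′ * 2 ^ e        ∎) , sym (trans (cong (_% 2) (+-comm 2 e)) ([m+n]%n≡m%n e 2))
  where open ≡-Reasoning

adjacent : ∀ {m} → Fin m → Permutation′ (suc m)
adjacent i = transpose (inject₁ i) (fsuc i)

inversions-adjacent : ∀ {m} (π : Permutation′ (suc m)) {i} → Descent π i →
                      inversions π ≡ suc (inversions (π ∘ₚ adjacent i))
inversions-adjacent π {i} = inversions-transpose π (cong suc (sym (Fin.toℕ-inject₁ i)))

module _ {m} {χ : Word (suc m) → Bool} (II : IsTypeII χ) where

  IndexParity : Permutation′ (suc m) → Set
  IndexParity π = ∃ λ e → card χ ≡ card (χ ∩ χ ∘ permute π) * 2 ^ e × e % 2 ≡ inversions π % 2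

  index-parity-identity : ∀ π → (∀ i → ¬ Descent π i) → IndexParity π
  index-parity-identity π ascending = 0 , card-fixed , cong (_% 2) (sym (inversions-identity π π≗id))
    where
    π≗id : ∀ k → π ⟨$⟩ʳ k ≡ k
    π≗id = no-descent⇒identity π ascending
    permute-π≡id : ∀ v → permute π v ≡ v
    permute-π≡id v = lookup-ext λ k → trans (lookup-permute π v k) (cong (lookup v) (π≗id k))
    card-fixed : card χ ≡ card (χ ∩ χ ∘ permute π) * 1
    card-fixed = trans (card-cong λ v → sym (trans (cong (λ w → χ v ∧ χ w) (permute-π≡id v))
                                                   (Bool.∧-idem (χ v))))
                       (sym (*-identityʳ _))

  index-parity-step : ∀ π {i} → Descent π i → IndexParity (π ∘ₚ adjacent i) → IndexParity π
  index-parity-step π {i} d (e , scaled , parity) =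
    let e′ , rescaled , parity′ = rescale e scaled nonempty bounded doubling
    in e′ , rescaled ,
       trans parity′ (trans (%2-suc {e} {inversions π′} parity) (cong (_% 2) (sym (inversions-adjacent π d))))
    where
    π′ = π ∘ₚ adjacent i
    nonempty : 1 ≤ card (χ ∩ χ ∘ permute π′)
    nonempty = ∈⇒1≤card (0ʷ∈ (∩-isSubspace (isSubspace (isSelfDual II))
                                           (isSubspace (IsSelfDual-permute (isSelfDual II) π′))))
    bounded : card (χ ∩ χ ∘ permute π) ≤ card χ
    bounded = card-mono λ v∈ → proj₁ (∩⁻ {χ = χ} {χ ∘ permute π} v∈)
    χπ′≗ : ∀ v → χ (permute π′ v) ≡ (χ ∘ permute π) (permute (adjacent i) v)
    χπ′≗ v = cong χ (permute-∘ₚ π (adjacent i) v)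
    doubling : card (χ ∩ χ ∘ permute π′) ≡ 2 * card (χ ∩ χ ∘ permute π)
             ⊎ card (χ ∩ χ ∘ permute π) ≡ 2 * card (χ ∩ χ ∘ permute π′)
    doubling with card-transpose II (IsTypeII-permute II π)
                    (<⇒≢ (AdjacentTransposition.a<b (cong suc (sym (Fin.toℕ-inject₁ i)))))
    ... | inj₁ c′≡2c = inj₁ (trans (card-cong λ v → cong (χ v ∧_) (χπ′≗ v)) c′≡2c)
    ... | inj₂ c≡2c′ = inj₂ (trans c≡2c′ (cong (2 *_) (card-cong λ v → cong (χ v ∧_) (sym (χπ′≗ v)))))

  index-parity : ∀ π → IndexParity π
  index-parity π = go π (ℕᵢ.<-wellFounded (inversions π))
    where
    go : ∀ π → Acc ℕ._<_ (inversions π) → IndexParity π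
    go π (acc rec) with descent? π
    ... | no ∄         = index-parity-identity π λ i d → ∄ (i , d)
    ... | yes (i , d) = index-parity-step π d (go (π ∘ₚ adjacent i)
      (rec (subst (inversions (π ∘ₚ adjacent i) ℕ.<_) (sym (inversions-adjacent π d)) (ℕₚ.n<1+n _))))

  automorphism-even : ∀ π → (∀ v → χ (permute π v) ≡ χ v) → inversions π % 2 ≡ 0
  automorphism-even π fixed with e , scaled , parity ← index-parity π = trans (sym parity) (cong (_% 2) e≡0)
    where
    full-index : card (χ ∩ χ ∘ permute π) ≡ card χ
    full-index = card-cong λ v → trans (cong (χ v ∧_) (fixed v)) (Bool.∧-idem (χ v))
    2ᵉ≡1 : 2 ^ e ≡ 1
    2ᵉ≡1 = sym (*-cancelˡ-≡ 1 (2 ^ e) (card χ) {{>-nonZero (∈⇒1≤card (0ʷ∈ (isSubspace (isSelfDual II))))}}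
      (trans (*-identityʳ (card χ)) (trans scaled (cong (_* 2 ^ e) full-index))))
    e≡0 : e ≡ 0
    e≡0 with m^n≡1⇒n≡0∨m≡1 2 e 2ᵉ≡1
    ... | inj₁ e≡0 = e≡0

Σ𝔽₂≡sum : ∀ {n} (f : Fin n → Bool) → Σ𝔽₂ f ≡ ⊕Σ.sum f
Σ𝔽₂≡sum {zero}  f = refl
Σ𝔽₂≡sum {suc n} f = cong (f fzero xor_) (Σ𝔽₂≡sum (f ∘ fsuc))

b-cong : ∀ {n} {f f′ g g′ : Vec𝔽₂ n} →
         (∀ i → f i ≡ f′ i) → (∀ i → g i ≡ g′ i) → b f g ≡ b f′ g′
b-cong {f = f} {f′} {g} {g′} f≗f′ g≗g′ = trans (Σ𝔽₂≡sum (λ i → f i ∧ g i))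
  (trans (⊕Σ.sum-cong-≗ λ i → cong₂ _∧_ (f≗f′ i) (g≗g′ i)) (sym (Σ𝔽₂≡sum (λ i → f′ i ∧ g′ i))))

b-lookup : ∀ {n} (x y : Word n) → b (lookup x) (lookup y) ≡ x ∙ y
b-lookup x y = Σ𝔽₂≡sum (λ k → lookup x k ∧ lookup y k)

wt-lookup : ∀ {n} (x : Word n) → wt (lookup x) ≡ weight x
wt-lookup x = sum-map-allFin (bit ∘ lookup x)

¬¬-decidable : ∀ {n} (P : Word n → Set) → ¬ ¬ (∀ v → Dec (P v))
¬¬-decidable {zero}  P ¬dec = ¬¬-excluded-middle λ P[]? → ¬dec λ { [] → P[]? }
¬¬-decidable {suc n} P ¬dec =
  ¬¬-decidable (P ∘ (false ∷_)) λ P₀? → ¬¬-decidable (P ∘ (true ∷_)) λ P₁? →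
    ¬dec λ { (false ∷ v) → P₀? v ; (true ∷ v) → P₁? v }

module FromPredicate {m} {C : Subset𝔽₂ (suc m)} (selfDual : SelfDual C) (C? : ∀ v → Dec (C (lookup v))) where

  χ : Word (suc m) → Bool
  χ v = does (C? v)

  private
    ∈χ⇒C : ∀ {v} → v ∈ χ → C (lookup v)
    ∈χ⇒C {v} (mem v∈) with C? v
    ... | yes Cv = Cv

    C⇒∈χ : ∀ {v} → C (lookup v) → v ∈ χ
    C⇒∈χ {v} Cv = mem (dec-true (C? v) Cv)

    C-resp-≗ : ∀ {f g} → (∀ i → f i ≡ g i) → C f → C g
    C-resp-≗ {f} {g} f≗g Cf = proj₂ (selfDual g) λ c Cc →
      trans (b-cong {g = c} (sym ∘ f≗g) (λ _ → refl)) (proj₁ (selfDual f) Cf c Cc)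

  χ-isSelfDual : IsSelfDual χ
  χ-isSelfDual = record
    { self-orthogonal = λ {x} {y} x∈ y∈ →
        trans (sym (b-lookup x y)) (proj₁ (selfDual (lookup x)) (∈χ⇒C x∈) (lookup y) (∈χ⇒C y∈))
    ; perp-closed     = λ {x} ⊥χ → C⇒∈χ (proj₂ (selfDual (lookup x)) λ c Cc →
        let c≗ = λ i → sym (lookup∘tabulate c i) in
        trans (b-cong {f = lookup x} (λ _ → refl) c≗)
          (trans (b-lookup x (tabulate c)) (⊥χ {tabulate c} (C⇒∈χ (C-resp-≗ c≗ Cc)))))
    }

  χ-isTypeII : DoublyEven C → IsTypeII χ
  χ-isTypeII doublyEven = record
    { isSelfDual  = χ-isSelfDual
    ; doubly-even = λ {x} x∈ → trans (cong (_% 4) (sym (wt-lookup x))) (doublyEven (lookup x) (∈χ⇒C x∈))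
    }

  χ-permute : ∀ {π} → InAut C π → ∀ v → χ (permute π v) ≡ χ v
  χ-permute {π} π∈Aut v = does-⇔ (mk⇔ to from) (C? (permute π v)) (C? v)
    where
    to : C (lookup (permute π v)) → C (lookup v)
    to Cπv = proj₁ (π∈Aut (lookup v))
      (lookup (permute π v) , Cπv , λ i → trans (lookup-permute π v (π ⟨$⟩ˡ i)) (cong (lookup v) (inverseʳ π)))
    from : C (lookup v) → C (lookup (permute π v))
    from Cv with c , Cc , c·π≗v ← proj₂ (π∈Aut (lookup v)) Cv = C-resp-≗
      (λ k → trans (cong c (sym (inverseˡ π))) (trans (c·π≗v (π ⟨$⟩ʳ k)) (sym (lookup-permute π v k)))) Cc

-- Membership in C need not be decidable, but evenness is, so decidability of C may be assumed.
theorem5p1 : (n : ℕ) → n ≥ 1 → (C : Subset𝔽₂ n) → IsLinearCode C → SelfDual C → DoublyEven C →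
    (π : Permutation′ n) → InAut C π → IsEven π
theorem5p1 (suc m) _ C _ selfDual doublyEven π π∈Aut =
  decidable-stable (inversions π % 2 ℕ.≟ 0) (¬¬-map even (¬¬-decidable (C ∘ lookup)))
  where
  even : (∀ v → Dec (C (lookup v))) → IsEven π
  even C? = automorphism-even (χ-isTypeII doublyEven) π (χ-permute {π} π∈Aut)
    where open FromPredicate selfDual C?
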